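{- Let $K_{p,q}$ be the complete bipartite graph of order $p+q$ with $q\ge p\ge 1$, and let $k$ be a positive integer. Then $d_R^k(K_{p,q})\le 2k$ if $p<k$ or $q=p=k$; $d_R^k(K_{p,q})\le \frac{2k(p+q)}{k+p}$ if $p+q\ge 2k+1$ and $k\le p\le 3k$; and $d_R^k(K_{p,q})\le \frac{p+q}{2}$ if $p\ge 3k$.
   Context: Let $k\ge1$ be an integer. A Roman $k$-dominating function (RkDF) on a graph $G$ is a map $f:V(G)\to\{0,1,2\}$ such that every vertex $v$ with $f(v)=0$ has at least $k$ neighbors $u$ with $f(u)=2$. A set $\{f_1,\ldots,f_d\}$ of pairwise distinct RkDFs on $G$ with $\sum_{i=1}^d f_i(v)\le 2k$ for every $v\in V(G)$ is a Roman $(k,k)$-dominating family on $G$; the maximum number of functions in such a family is the Roman $(k,k)$-domatic number $d_R^k(G)$. -}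

module Defs where

open import Data.Nat using (ℕ; _+_; _*_; _≤_; _<?_; _≡ᵇ_)
open import Data.Fin using (Fin; toℕ)
open import Data.Bool using (Bool; true; false; if_then_else_; _∧_; _xor_)
open import Data.List using (List; map; allFin)
open import Data.Nat.ListAction using (sum)
open import Data.List.Relation.Unary.All using (All)
open import Data.List.Relation.Unary.AllPairs using (AllPairs)
open import Relation.Binary.PropositionalEquality using (_≡_; refl)
open import Data.Product using (_×_)
open import Data.Bool.Properties using (xor-same)
open import Relation.Nullary using (¬_)
open import Relation.Nullary.Decidable using (⌊_⌋)

record Graph (n : ℕ) : Set where
  field
    adj     : Fin n → Fin n → Bool
    symm    : ∀ u v → adj u v ≡ adj v u
    irrefl  : ∀ v → adj v v ≡ false
open Graph public

-- Complete bipartite graph K_{p,q} on Fin (p + q):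
-- vertices with index < p form one side, the remaining q vertices the other.
side : ∀ {n} → ℕ → Fin n → Bool
side p i = ⌊ toℕ i <? p ⌋


twoNeighbours : ∀ {n} → Graph n → (Fin n → ℕ) → Fin n → ℕ
twoNeighbours {n} G f v =
  sum (map (λ u → if adj G v u ∧ (f u ≡ᵇ 2) then 1 else 0) (allFin n))

IsRkDF : ∀ {n} → ℕ → Graph n → (Fin n → ℕ) → Set
IsRkDF {n} k G f =
  (∀ v → f v ≤ 2) × (∀ v → f v ≡ 0 → k ≤ twoNeighbours G f v)

IsRkkFamily : ∀ {n} → ℕ → Graph n → List (Fin n → ℕ) → Set
IsRkkFamily {n} k G fs =
  All (IsRkDF k G) fs
  × AllPairs (λ f g → ¬ (∀ v → f v ≡ g v)) fs
  × (∀ v → sum (map (λ f → f v) fs) ≤ 2 * k)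

completeBipartite : (p q : ℕ) → Graph (p + q)
completeBipartite p q = record
  { adj = λ u v → side p u xor side p v
  ; symm = λ u v → xor-comm (side p u) (side p v)
  ; irrefl = λ v → xor-same (side p v)
  }
  where
  xor-comm : ∀ a b → (a xor b) ≡ (b xor a)
  xor-comm false false = refl
  xor-comm false true = refl
  xor-comm true false = refl
  xor-comm true true = refl

module Submission where

-- The argument is a weight count.  If f₁,…,f_d is a Roman (k,k)-dominating
-- family, every vertex receives total weight at most 2k, so the weights
-- w(fᵢ) = ∑_v fᵢ(v) add up to at most 2k(p+q); hence d·m ≤ 2k(p+q) whenever
-- m is a lower bound for the weight of every single RkDF.
--
-- For an RkDF f on K_{p,q} write a and b for its restrictions to the two
-- sides.  On a side without zeros every value is ≥ 1 and every 2 adds one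
-- more, so the side weighs at least (size + number of twos); on any side the
-- weight is at least twice the number of twos; and a zero on one side forces
-- at least k twos on the other.  Splitting into four cases according to
-- which sides contain a zero gives a lower bound for w(f), and choosing
-- m = p+q, k+p and 4k respectively yields the three parts of the corollary.

open import Defs
open import Data.Bool using (Bool; true; false; if_then_else_; _∧_; _xor_)
open import Data.Fin using (Fin; zero; suc; toℕ; _↑ˡ_; _↑ʳ_)
open import Data.Fin.Properties using (toℕ<n; toℕ-↑ˡ; toℕ-↑ʳ; any?)
open import Data.List using (List; []; _∷_; length; map; allFin; tabulate)
open import Data.List.Properties using (map-tabulate)
open import Data.List.Relation.Unary.All as All using (All; []; _∷_)
open import Data.Nat using (ℕ; zero; suc; _+_; _*_; _≤_; _<_; _≡ᵇ_; _<?_; _≟_; z≤n; s≤s; NonZero; >-nonZero)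
open import Data.Nat.ListAction using (sum)
open import Data.Nat.Properties
open import Algebra.Properties.CommutativeMonoid.Sum +-0-commutativeMonoid
  using (∑-distrib-+; sum-cong-≗; sum-replicate-zero) renaming (sum to ∑)
open import Data.Nat.Tactic.RingSolver using (solve-∀)
open import Data.Product using (_×_; _,_)
open import Data.Sum using (_⊎_; inj₁; inj₂)
open import Function using (_∘_)
open import Relation.Binary.PropositionalEquality
open import Relation.Nullary using (yes; no; contradiction)
open import Relation.Nullary.Decidable using (dec-true; dec-false; isYes≗does)

sum-tabulate : ∀ {n} (g : Fin n → ℕ) → sum (tabulate g) ≡ ∑ g
sum-tabulate {zero}  g = refl
sum-tabulate {suc n} g = cong (g zero +_) (sum-tabulate (g ∘ suc))

sum-allFin : ∀ {n} (g : Fin n → ℕ) → sum (map g (allFin n)) ≡ ∑ g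
sum-allFin {n} g = trans (cong sum (map-tabulate (λ i → i) g)) (sum-tabulate g)

∑-mono : ∀ {n} {g h : Fin n → ℕ} → (∀ i → g i ≤ h i) → ∑ g ≤ ∑ h
∑-mono {zero}  g≤h = z≤n
∑-mono {suc n} g≤h = +-mono-≤ (g≤h zero) (∑-mono (g≤h ∘ suc))

∑-const : ∀ n (c : ℕ) → ∑ {n} (λ _ → c) ≡ n * c
∑-const zero    c = refl
∑-const (suc n) c = cong (c +_) (∑-const n c)

∑-split : ∀ m {n} (g : Fin (m + n) → ℕ) →
          ∑ g ≡ ∑ (g ∘ (_↑ˡ n)) + ∑ (g ∘ (m ↑ʳ_))
∑-split zero    g = refl
∑-split (suc m) g = trans (cong (g zero +_) (∑-split m (g ∘ suc))) (sym (+-assoc (g zero) _ _))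

isTwo : ℕ → ℕ
isTwo x = if x ≡ᵇ 2 then 1 else 0

twos : ∀ {n} → (Fin n → ℕ) → ℕ
twos a = ∑ (λ i → isTwo (a i))

isTwo≤1 : ∀ x → isTwo x ≤ 1
isTwo≤1 0                   = z≤n
isTwo≤1 1                   = z≤n
isTwo≤1 2                   = s≤s z≤n
isTwo≤1 (suc (suc (suc x))) = z≤n

twice-isTwo≤ : ∀ x → isTwo x + isTwo x ≤ x
twice-isTwo≤ 0                   = z≤n
twice-isTwo≤ 1                   = z≤n
twice-isTwo≤ 2                   = ≤-refl
twice-isTwo≤ (suc (suc (suc x))) = z≤n

positive-isTwo≤ : ∀ x → 1 ≤ x → 1 + isTwo x ≤ x
positive-isTwo≤ 1                   _ = ≤-refl
positive-isTwo≤ 2                   _ = ≤-refl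
positive-isTwo≤ (suc (suc (suc x))) _ = s≤s z≤n

twos≤size : ∀ {n} (a : Fin n → ℕ) → twos a ≤ n
twos≤size {n} a = ≤-trans (∑-mono (isTwo≤1 ∘ a)) (≤-reflexive (trans (∑-const n 1) (*-identityʳ n)))

twos+twos≤weight : ∀ {n} (a : Fin n → ℕ) → twos a + twos a ≤ ∑ a
twos+twos≤weight a = subst (_≤ ∑ a) (∑-distrib-+ (isTwo ∘ a) (isTwo ∘ a)) (∑-mono (twice-isTwo≤ ∘ a))

size+twos≤weight : ∀ {n} (a : Fin n → ℕ) → (∀ i → 1 ≤ a i) → n + twos a ≤ ∑ a
size+twos≤weight {n} a positive = begin
  n + twos a                      ≡⟨ cong (_+ twos a) (sym (trans (∑-const n 1) (*-identityʳ n))) ⟩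
  ∑ {n} (λ _ → 1) + twos a        ≡⟨ sym (∑-distrib-+ (λ _ → 1) (isTwo ∘ a)) ⟩
  ∑ (λ i → 1 + isTwo (a i))       ≤⟨ ∑-mono (λ i → positive-isTwo≤ (a i) (positive i)) ⟩
  ∑ a                             ∎
  where open ≤-Reasoning

record CrossDominated (k : ℕ) {p q : ℕ} (a : Fin p → ℕ) (b : Fin q → ℕ) : Set where
  field
    zero-left  : ∀ i → a i ≡ 0 → k ≤ twos b
    zero-right : ∀ j → b j ≡ 0 → k ≤ twos a

side-dichotomy : ∀ {n} k (a : Fin n → ℕ) (t : ℕ) → (∀ i → a i ≡ 0 → k ≤ t) →
                 (∀ i → 1 ≤ a i) ⊎ k ≤ t
side-dichotomy k a t zero⇒ with any? (λ i → a i ≟ 0)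
... | yes (i , aᵢ≡0) = inj₂ (zero⇒ i aᵢ≡0)
... | no  no-zero    = inj₁ (λ i → n≢0⇒n>0 (λ aᵢ≡0 → no-zero (i , aᵢ≡0)))

-- m lies below the weight bound of each of the four zero patterns of a pair
-- of side labellings: no zeros; zeros only on the left (which forces k twos
-- on the right, so k ≤ q); zeros only on the right; zeros on both sides.
record BelowCaseBounds (k p q m : ℕ) : Set where
  field
    no-zeros    : m ≤ p + q
    left-zeros  : k ≤ q → m ≤ q + k
    right-zeros : k ≤ p → m ≤ p + k
    both-zeros  : k ≤ p → k ≤ q → m ≤ (k + k) + (k + k)

cross-weight-bound : ∀ {k p q} {a : Fin p → ℕ} {b : Fin q → ℕ} (m : ℕ) →
  BelowCaseBounds k p q m → CrossDominated k a b → m ≤ ∑ a + ∑ b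
cross-weight-bound {k} {p} {q} {a} {b} m below dom
  with side-dichotomy k a (twos b) (CrossDominated.zero-left dom)
     | side-dichotomy k b (twos a) (CrossDominated.zero-right dom)
... | inj₁ a>0 | inj₁ b>0 = begin
  m                       ≤⟨ no-zeros ⟩
  p + q                   ≤⟨ +-mono-≤ (m≤m+n p (twos a)) (m≤m+n q (twos b)) ⟩
  (p + twos a) + (q + twos b) ≤⟨ +-mono-≤ (size+twos≤weight a a>0) (size+twos≤weight b b>0) ⟩
  ∑ a + ∑ b               ∎
  where open ≤-Reasoning; open BelowCaseBounds below
... | inj₂ k≤tb | inj₁ b>0 = begin
  m                       ≤⟨ left-zeros (≤-trans k≤tb (twos≤size b)) ⟩
  q + k                   ≤⟨ +-monoʳ-≤ q k≤tb ⟩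
  q + twos b              ≤⟨ size+twos≤weight b b>0 ⟩
  ∑ b                     ≤⟨ m≤n+m (∑ b) (∑ a) ⟩
  ∑ a + ∑ b               ∎
  where open ≤-Reasoning; open BelowCaseBounds below
... | inj₁ a>0 | inj₂ k≤ta = begin
  m                       ≤⟨ right-zeros (≤-trans k≤ta (twos≤size a)) ⟩
  p + k                   ≤⟨ +-monoʳ-≤ p k≤ta ⟩
  p + twos a              ≤⟨ size+twos≤weight a a>0 ⟩
  ∑ a                     ≤⟨ m≤m+n (∑ a) (∑ b) ⟩
  ∑ a + ∑ b               ∎
  where open ≤-Reasoning; open BelowCaseBounds below
... | inj₂ k≤tb | inj₂ k≤ta = begin
  m                       ≤⟨ both-zeros (≤-trans k≤ta (twos≤size a)) (≤-trans k≤tb (twos≤size b)) ⟩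
  (k + k) + (k + k)       ≤⟨ +-mono-≤ (+-mono-≤ k≤ta k≤ta) (+-mono-≤ k≤tb k≤tb) ⟩
  (twos a + twos a) + (twos b + twos b) ≤⟨ +-mono-≤ (twos+twos≤weight a) (twos+twos≤weight b) ⟩
  ∑ a + ∑ b               ∎
  where open ≤-Reasoning; open BelowCaseBounds below

module _ (p q : ℕ) where

  side-left : (i : Fin p) → side p (i ↑ˡ q) ≡ true
  side-left i = trans (isYes≗does (toℕ (i ↑ˡ q) <? p))
    (dec-true (toℕ (i ↑ˡ q) <? p) (subst (_< p) (sym (toℕ-↑ˡ i q)) (toℕ<n i)))

  side-right : (j : Fin q) → side p (p ↑ʳ j) ≡ false
  side-right j = trans (isYes≗does (toℕ (p ↑ʳ j) <? p))
    (dec-false (toℕ (p ↑ʳ j) <? p) (λ lt → <⇒≱ lt p≤j))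
    where
    p≤j : p ≤ toℕ (p ↑ʳ j)
    p≤j = subst (p ≤_) (sym (toℕ-↑ʳ p j)) (m≤m+n p (toℕ j))

  neighbour-term : (f : Fin (p + q) → ℕ) {v u : Fin (p + q)} {s t : Bool} →
    side p v ≡ s → side p u ≡ t →
    (if adj (completeBipartite p q) v u ∧ (f u ≡ᵇ 2) then 1 else 0)
      ≡ (if (s xor t) ∧ (f u ≡ᵇ 2) then 1 else 0)
  neighbour-term f refl refl = refl

  twoNeighbours-split : (f : Fin (p + q) → ℕ) {v : Fin (p + q)} {s : Bool} → side p v ≡ s →
    twoNeighbours (completeBipartite p q) f v
      ≡ ∑ (λ i → if (s xor true) ∧ (f (i ↑ˡ q) ≡ᵇ 2) then 1 else 0)
        + ∑ (λ j → if (s xor false) ∧ (f (p ↑ʳ j) ≡ᵇ 2) then 1 else 0)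
  twoNeighbours-split f {v} sv = begin
    twoNeighbours (completeBipartite p q) f v ≡⟨ sum-allFin term ⟩
    ∑ term                                    ≡⟨ ∑-split p term ⟩
    ∑ (term ∘ (_↑ˡ q)) + ∑ (term ∘ (p ↑ʳ_))   ≡⟨ cong₂ _+_ (sum-cong-≗ {p} (λ i → neighbour-term f sv (side-left i)))
                                                           (sum-cong-≗ {q} (λ j → neighbour-term f sv (side-right j))) ⟩
    _                                         ∎
    where
    open ≡-Reasoning
    term : Fin (p + q) → ℕ
    term u = if adj (completeBipartite p q) v u ∧ (f u ≡ᵇ 2) then 1 else 0

  twoNeighbours-left : (f : Fin (p + q) → ℕ) (i : Fin p) →
    twoNeighbours (completeBipartite p q) f (i ↑ˡ q) ≡ twos (f ∘ (p ↑ʳ_))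
  twoNeighbours-left f i =
    trans (twoNeighbours-split f (side-left i)) (cong (_+ twos (f ∘ (p ↑ʳ_))) (sum-replicate-zero p))

  twoNeighbours-right : (f : Fin (p + q) → ℕ) (j : Fin q) →
    twoNeighbours (completeBipartite p q) f (p ↑ʳ j) ≡ twos (f ∘ (_↑ˡ q))
  twoNeighbours-right f j = trans (twoNeighbours-split f (side-right j))
    (trans (cong (twos (f ∘ (_↑ˡ q)) +_) (sum-replicate-zero q)) (+-identityʳ (twos (f ∘ (_↑ˡ q)))))

  rkdf-cross-dominated : ∀ {k} {f : Fin (p + q) → ℕ} → IsRkDF k (completeBipartite p q) f →
    CrossDominated k (f ∘ (_↑ˡ q)) (f ∘ (p ↑ʳ_))
  rkdf-cross-dominated {k} {f} (_ , dom) = record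
    { zero-left  = λ i z → subst (k ≤_) (twoNeighbours-left f i) (dom (i ↑ˡ q) z)
    ; zero-right = λ j z → subst (k ≤_) (twoNeighbours-right f j) (dom (p ↑ʳ j) z)
    }

rkdf-weight-bound : ∀ {k p q} {f : Fin (p + q) → ℕ} (m : ℕ) → BelowCaseBounds k p q m →
  IsRkDF k (completeBipartite p q) f → m ≤ ∑ f
rkdf-weight-bound {p = p} {q} {f} m below rkdf =
  subst (m ≤_) (sym (∑-split p f)) (cross-weight-bound m below (rkdf-cross-dominated p q rkdf))

∑-family : ∀ {n} (fs : List (Fin n → ℕ)) →
  sum (map ∑ fs) ≡ ∑ (λ v → sum (map (λ f → f v) fs))
∑-family {n} []       = sym (sum-replicate-zero n)
∑-family     (f ∷ fs) = trans (cong (∑ f +_) (∑-family fs)) (sym (∑-distrib-+ f _))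

length*≤total : ∀ {n} (m : ℕ) (fs : List (Fin n → ℕ)) → All (λ f → m ≤ ∑ f) fs →
  length fs * m ≤ sum (map ∑ fs)
length*≤total m []       []          = z≤n
length*≤total m (f ∷ fs) (m≤f ∷ m≤fs) = +-mono-≤ m≤f (length*≤total m fs m≤fs)

family-bound : ∀ {n k} {G : Graph n} {fs : List (Fin n → ℕ)} (m : ℕ) → IsRkkFamily k G fs →
  (∀ {f} → IsRkDF k G f → m ≤ ∑ f) → length fs * m ≤ n * (2 * k)
family-bound {n} {k} {fs = fs} m (members , _ , load) weight = begin
  length fs * m                          ≤⟨ length*≤total m fs (All.map weight members) ⟩
  sum (map ∑ fs)                         ≡⟨ ∑-family fs ⟩
  ∑ (λ v → sum (map (λ f → f v) fs))     ≤⟨ ∑-mono load ⟩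
  ∑ {n} (λ _ → 2 * k)                    ≡⟨ ∑-const n (2 * k) ⟩
  n * (2 * k)                            ∎
  where open ≤-Reasoning

-- 4k rewritten as 3k + k, for comparing with the hypotheses 3k ≤ p, p ≤ 3k.
four≡three+one : ∀ k → (k + k) + (k + k) ≡ 3 * k + k
four≡three+one = solve-∀

small-bounds : ∀ {k p q} → (p < k ⊎ (q ≡ p × p ≡ k)) → BelowCaseBounds k p q (p + q)
small-bounds {k} {p} {q} (inj₁ p<k) = record
  { no-zeros    = ≤-refl
  ; left-zeros  = λ _ → ≤-trans (≤-reflexive (+-comm p q)) (+-monoʳ-≤ q (<⇒≤ p<k))
  ; right-zeros = λ k≤p → contradiction k≤p (<⇒≱ p<k)
  ; both-zeros  = λ k≤p _ → contradiction k≤p (<⇒≱ p<k)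
  }
small-bounds {k} (inj₂ (refl , refl)) = record
  { no-zeros    = ≤-refl
  ; left-zeros  = λ _ → ≤-refl
  ; right-zeros = λ _ → ≤-refl
  ; both-zeros  = λ _ _ → m≤m+n (k + k) (k + k)
  }

middle-bounds : ∀ {k p q} → p ≤ q → k ≤ p → p ≤ 3 * k → BelowCaseBounds k p q (k + p)
middle-bounds {k} {p} {q} p≤q k≤p p≤3k = record
  { no-zeros    = ≤-trans (≤-reflexive (+-comm k p)) (+-monoʳ-≤ p (≤-trans k≤p p≤q))
  ; left-zeros  = λ _ → ≤-trans (+-monoʳ-≤ k p≤q) (≤-reflexive (+-comm k q))
  ; right-zeros = λ _ → ≤-reflexive (+-comm k p)
  ; both-zeros  = λ _ _ → ≤-trans (+-monoʳ-≤ k p≤3k)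
                            (≤-reflexive (trans (+-comm k (3 * k)) (sym (four≡three+one k))))
  }

large-bounds : ∀ {k p q} → p ≤ q → 3 * k ≤ p → BelowCaseBounds k p q ((k + k) + (k + k))
large-bounds {k} {p} {q} p≤q 3k≤p = record
  { no-zeros    = subst (_≤ p + q) (sym (four≡three+one k)) (+-mono-≤ 3k≤p (≤-trans k≤3k (≤-trans 3k≤p p≤q)))
  ; left-zeros  = λ _ → subst (_≤ q + k) (sym (four≡three+one k)) (+-monoˡ-≤ k (≤-trans 3k≤p p≤q))
  ; right-zeros = λ _ → subst (_≤ p + k) (sym (four≡three+one k)) (+-monoˡ-≤ k 3k≤p)
  ; both-zeros  = λ _ _ → ≤-refl
  }
  where
  k≤3k : k ≤ 3 * k
  k≤3k = m≤m+n k (2 * k)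

corollary4 : (p q k : ℕ) → 1 ≤ p → p ≤ q → 1 ≤ k →
    (fs : List (Fin (p + q) → ℕ)) → IsRkkFamily k (completeBipartite p q) fs →
      ((p < k ⊎ (q ≡ p × p ≡ k)) → length fs ≤ 2 * k)
      × ((2 * k + 1 ≤ p + q × k ≤ p × p ≤ 3 * k) → length fs * (k + p) ≤ 2 * k * (p + q))
      × (3 * k ≤ p → 2 * length fs ≤ p + q)
corollary4 p q k 1≤p p≤q 1≤k fs family =
    (λ small → *-cancelʳ-≤ (length fs) (2 * k) (p + q) {{p+q≢0}} (bound (p + q) (small-bounds small)))
  , (λ { (_ , k≤p , p≤3k) → bound (k + p) (middle-bounds p≤q k≤p p≤3k) })
  , (λ 3k≤p → *-cancelˡ-≤ (2 * k) {{2k≢0}}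
       (subst (_≤ 2 * k * (p + q)) (quadruple≡ (length fs) k) (bound _ (large-bounds p≤q 3k≤p))))
  where
  bound : (m : ℕ) → BelowCaseBounds k p q m → length fs * m ≤ 2 * k * (p + q)
  bound m below =
    ≤-trans (family-bound {k = k} {G = completeBipartite p q} {fs = fs} m family
               (λ {f} → rkdf-weight-bound {f = f} m below))
            (≤-reflexive (*-comm (p + q) (2 * k)))

  quadruple≡ : ∀ d c → d * ((c + c) + (c + c)) ≡ 2 * c * (2 * d)
  quadruple≡ = solve-∀

  p+q≢0 : NonZero (p + q)
  p+q≢0 = >-nonZero (≤-trans 1≤p (m≤m+n p q))

  2k≢0 : NonZero (2 * k)
  2k≢0 = >-nonZero (≤-trans 1≤k (m≤m+n k (1 * k)))
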